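{- (Typing for Data Structures.) Let $\Gamma$ be a typing context, $d$ a data structure and $A$ a $\mu$-type with $\Gamma\vdash d : A$ derivable. Then there exists a $\mu$-datatype $D$ which is a non-union type such that $D\preceq_\mu A$ and $\Gamma\vdash d : D$ is derivable. Moreover: (1) if $d = \mathsf c$ (a constant), then $D \simeq_\mu \mathsf c$; (2) if $d = d'\,t$, then there exist $D', A'$ such that $D \simeq_\mu D' @ A'$, $\Gamma\vdash d' : D'$ and $\Gamma\vdash t : A'$ are derivable.
   Context: Data structures: $d ::= \mathsf{c} \mid d\,t$ with $t$ an arbitrary term. Types. Fix disjoint countably infinite sets of datatype variables $\alpha,\dots$, type variables $X,\dots$ and type constants $\mathsf c,\dots$ (a term constant $\mathsf c$ has the homonymous type constant as type); $V,W$ range over variables. $\mu$-datatypes $D ::= \alpha \mid \mathsf{c} \mid D @ A \mid D \oplus D \mid \mu\alpha.D$; $\mu$-types $A ::= X \mid D \mid A \supset A \mid A \oplus A \mid \mu X.A$, all required contractive ($V$ occurs in $A$ in $\mu V.A$ only under $\supset$ or $@$). A non-union type is one of the forms $\alpha$, $\mathsf c$, $D@A$, $X$, $A\supset B$, or $\mu V.A$ with $A$ non-union. $\bigoplus_{i\in1..n}A_i$ denotes an iterated union in any association. $\simeq_\mu$ is the least relation closed under reflexivity, symmetry, transitivity, congruence for $\supset,@,\oplus,\mu V$, and the axioms $A\oplus A\simeq A$, $A\oplus B\simeq B\oplus A$, $A\oplus(B\oplus C)\simeq(A\oplus B)\oplus C$, $\mu V.A\simeq A\{V:=\mu V.A\}$,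 and: $A\simeq B\{V:=A\}$ with $\mu V.B$ contractive implies $A\simeq\mu V.B$. Subtyping $\Sigma\vdash A\preceq_\mu B$ ($\Sigma$ a set of assumptions $V\preceq_\mu W$): reflexivity; $\Sigma,V\preceq W\vdash V\preceq W$; $\simeq_\mu\subseteq\preceq_\mu$; transitivity; $D\preceq D'$, $A\preceq A'$ give $D@A\preceq D'@A'$; $A\preceq A'$, $B\preceq B'$ give $A'\supset B\preceq A\supset B'$; $A\preceq C$, $B\preceq C$ give $A\oplus B\preceq C$; $A\preceq B$ gives $A\preceq B\oplus C$ and $A\preceq C\oplus B$; $\Sigma,V\preceq W\vdash A\preceq B$ with $W\notin fv(A)$, $V\notin fv(B)$ gives $\Sigma\vdash\mu V.A\preceq\mu W.B$. $A\preceq_\mu B$ means derivable with empty $\Sigma$. Calculus. Patterns $p ::= x \mid \mathsf{c} \mid p\,p$ (linear; $fm(p)$ its variables). Terms $t ::= x \mid \mathsf{c} \mid t\,t \mid (p_1\to_{\theta_1} t_1 \mid \dots \mid p_n\to_{\theta_n} t_n)$. Typing (typing contexts are partial maps from variables to $\mu$-types). Patterns: $\theta\vdash_p x:\theta(x)$; $\theta\vdash_p\mathsf{c}:\mathsf{c}$; $\theta\vdash_p p:D$ and $\theta\vdash_p q:A$ give $\theta\vdash_p p\,q:D@A$. Terms: $\Gamma\vdash x:\Gamma(x)$; $\Gamma\vdash\mathsf{c}:\mathsf{c}$; $\Gamma\vdash r:D$, $\Gamma\vdash u:A$ give $\Gamma\vdash r\,u:D@A$; if $[\theta_i\vdash p_i:A_i]_{i}$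 is compatible, $\theta_i\vdash_p p_i:A_i$, $dom(\theta_i)=fm(p_i)$ and $\Gamma,\theta_i\vdash s_i:B$ for all $i\in1..n$ then $\Gamma\vdash(p_i\to_{\theta_i}s_i)_{i\in1..n}:(\bigoplus_iA_i)\supset B$; $\Gamma\vdash r:(\bigoplus_{i\in1..n}A_i)\supset B$ and $\Gamma\vdash u:A_k$ ($k\in1..n$) give $\Gamma\vdash r\,u:B$; $\Gamma\vdash s:A$ and $A\preceq_\mu A'$ give $\Gamma\vdash s:A'$. Compatibility of a list $[\theta_i\vdash p_i:A_i]$ means: for $i<j$, (1) if $p_i$ subsumes $p_j$ ($\sigma p_i=p_j$ for some $\sigma$) then $A_j\preceq_\mu A_i$; (2) otherwise, if $A_i\|\pi\cap A_j\|\pi\neq\varnothing$ for every maximal position $\pi$ of $pos(p_i)\cap pos(p_j)$ at which $p_i|_\pi$ does not subsume $p_j|_\pi$, then $A_j\preceq_\mu A_i$; where $a\|\epsilon=\{a\}$, $(A_1\star A_2)\|\epsilon=\{\star\}$, $(A_1\star A_2)\|i\pi=A_i\|\pi$ ($\star\in\{\supset,@\}$), $(A_1\oplus A_2)\|\pi=A_1\|\pi\cup A_2\|\pi$, $(\mu V.A)\|\pi=(A\{V:=\mu V.A\})\|\pi$. -}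

module Defs where

-- Locally nameless encoding of mu-types (bound variables: de Bruijn indices,
-- free variables: names), and the pattern calculus with its type system.

open import Data.Nat using (ℕ; zero; suc; _≟_)
open import Data.Bool using (Bool; true; false)
open import Data.Product using (Σ; ∃; ∃-syntax; _×_; _,_; proj₁; proj₂)
open import Data.List using (List; []; _∷_; _++_; map; [_])
open import Data.List.Membership.Propositional using (_∈_; _∉_)
open import Data.List.Relation.Unary.All using (All)
open import Data.List.Relation.Unary.Unique.Propositional using (Unique)
open import Data.Maybe using (Maybe; just; nothing)
open import Data.Unit using (⊤)
open import Relation.Nullary using (¬_; yes; no)
open import Relation.Binary.PropositionalEquality using (_≡_; _≢_)

-- dsort: datatype variables α ; tsort: type variables X (disjoint sets)
data Sort : Set where
  dsort tsort : Sort

Var : Set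
Var = Sort × ℕ

infixr 6 _⊃_
infixl 7 _⊕_
infixl 8 _＠_

data Ty : Set where
  fv    : Var → Ty
  bv    : ℕ → Ty
  con   : ℕ → Ty
  _＠_  : Ty → Ty → Ty
  _⊃_   : Ty → Ty → Ty
  _⊕_   : Ty → Ty → Ty
  μ     : Sort → Ty → Ty    -- μα.D (dsort) or μX.A (tsort)

openRec : ℕ → Ty → Ty → Ty
openRec k U (fv V) = fv V
openRec k U (bv i) with i ≟ k
... | yes _ = U
... | no _  = bv i
openRec k U (con c) = con c
openRec k U (A ＠ B) = openRec k U A ＠ openRec k U B
openRec k U (A ⊃ B) = openRec k U A ⊃ openRec k U B
openRec k U (A ⊕ B) = openRec k U A ⊕ openRec k U B
openRec k U (μ s A) = μ s (openRec (suc k) U A)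

open' : Ty → Ty → Ty
open' A U = openRec 0 U A

fvs : Ty → List Var
fvs (fv V) = V ∷ []
fvs (bv i) = []
fvs (con c) = []
fvs (A ＠ B) = fvs A ++ fvs B
fvs (A ⊃ B) = fvs A ++ fvs B
fvs (A ⊕ B) = fvs A ++ fvs B
fvs (μ s A) = fvs A

lookupS : List Sort → ℕ → Maybe Sort
lookupS [] i = nothing
lookupS (s ∷ ss) zero = just s
lookupS (s ∷ ss) (suc i) = lookupS ss i

-- Grammar: DT ss D  -- D is a μ-datatype;  TY ss A -- A is a μ-type,
-- under binders of sorts ss (innermost first).
data DT (ss : List Sort) : Ty → Set
data TY (ss : List Sort) : Ty → Set

data DT ss where
  dfv  : ∀ n → DT ss (fv (dsort , n))
  dbv  : ∀ i → lookupS ss i ≡ just dsort → DT ss (bv i)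
  dcon : ∀ c → DT ss (con c)
  d＠   : ∀ {D A} → DT ss D → TY ss A → DT ss (D ＠ A)
  d⊕   : ∀ {D D'} → DT ss D → DT ss D' → DT ss (D ⊕ D')
  dμ   : ∀ {D} → DT (dsort ∷ ss) D → DT ss (μ dsort D)

data TY ss where
  tfv  : ∀ n → TY ss (fv (tsort , n))
  tbv  : ∀ i → lookupS ss i ≡ just tsort → TY ss (bv i)
  tdt  : ∀ {D} → DT ss D → TY ss D
  t⊃   : ∀ {A B} → TY ss A → TY ss B → TY ss (A ⊃ B)
  t⊕   : ∀ {A B} → TY ss A → TY ss B → TY ss (A ⊕ B)
  tμ   : ∀ {A} → TY (tsort ∷ ss) A → TY ss (μ tsort A)

Guarded : ℕ → Ty → Set
Guarded k (fv V) = ⊤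
Guarded k (bv i) = i ≢ k
Guarded k (con c) = ⊤
Guarded k (A ＠ B) = ⊤
Guarded k (A ⊃ B) = ⊤
Guarded k (A ⊕ B) = Guarded k A × Guarded k B
Guarded k (μ s A) = Guarded (suc k) A

Contr : Ty → Set
Contr (fv V) = ⊤
Contr (bv i) = ⊤
Contr (con c) = ⊤
Contr (A ＠ B) = Contr A × Contr B
Contr (A ⊃ B) = Contr A × Contr B
Contr (A ⊕ B) = Contr A × Contr B
Contr (μ s A) = Guarded 0 A × Contr A

IsType : Ty → Set
IsType A = TY [] A × Contr A

IsDatatype : Ty → Set
IsDatatype D = DT [] D × Contr D

data NonUnion : Ty → Set where
  nufv  : ∀ V → NonUnion (fv V)
  nubv  : ∀ i → NonUnion (bv i)
  nucon : ∀ c → NonUnion (con c)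
  nu＠   : ∀ D A → NonUnion (D ＠ A)
  nu⊃   : ∀ A B → NonUnion (A ⊃ B)
  nuμ   : ∀ s {A} → NonUnion A → NonUnion (μ s A)

infix 4 _≃_
data _≃_ : Ty → Ty → Set where
  ≃refl  : ∀ {A} → IsType A → A ≃ A
  ≃sym   : ∀ {A B} → A ≃ B → B ≃ A
  ≃trans : ∀ {A B C} → A ≃ B → B ≃ C → A ≃ C
  ≃＠     : ∀ {D D' A A'} → D ≃ D' → A ≃ A' →
           IsType (D ＠ A) → IsType (D' ＠ A') → (D ＠ A) ≃ (D' ＠ A')
  ≃⊃     : ∀ {A A' B B'} → A ≃ A' → B ≃ B' → (A ⊃ B) ≃ (A' ⊃ B')
  ≃⊕     : ∀ {A A' B B'} → A ≃ A' → B ≃ B' → (A ⊕ B) ≃ (A' ⊕ B')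
  ≃μ     : ∀ {s A B} (V : ℕ) → (s , V) ∉ fvs A → (s , V) ∉ fvs B →
           open' A (fv (s , V)) ≃ open' B (fv (s , V)) →
           IsType (μ s A) → IsType (μ s B) → μ s A ≃ μ s B
  ≃idem  : ∀ {A} → IsType A → (A ⊕ A) ≃ A
  ≃comm  : ∀ {A B} → IsType A → IsType B → (A ⊕ B) ≃ (B ⊕ A)
  ≃assoc : ∀ {A B C} → IsType A → IsType B → IsType C →
           (A ⊕ (B ⊕ C)) ≃ ((A ⊕ B) ⊕ C)
  ≃fold  : ∀ {s A} → IsType (μ s A) → μ s A ≃ open' A (μ s A)
  ≃contr : ∀ {s A B} → A ≃ open' B A → IsType (μ s B) → A ≃ μ s B

Assum : Set
Assum = List (Var × Var)

assumVars : Assum → List Var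
assumVars [] = []
assumVars ((V , W) ∷ S) = V ∷ W ∷ assumVars S

infix 4 _⊢_⪯_
data _⊢_⪯_ : Assum → Ty → Ty → Set where
  ⪯refl  : ∀ {S A} → IsType A → S ⊢ A ⪯ A
  ⪯hyp   : ∀ {S V W} → (V , W) ∈ S → S ⊢ fv V ⪯ fv W
  ⪯eq    : ∀ {S A B} → A ≃ B → S ⊢ A ⪯ B
  ⪯trans : ∀ {S A B C} → S ⊢ A ⪯ B → S ⊢ B ⪯ C → S ⊢ A ⪯ C
  ⪯＠     : ∀ {S D D' A A'} → S ⊢ D ⪯ D' → S ⊢ A ⪯ A' →
           IsType (D ＠ A) → IsType (D' ＠ A') → S ⊢ (D ＠ A) ⪯ (D' ＠ A')
  ⪯⊃     : ∀ {S A A' B B'} → S ⊢ A ⪯ A' → S ⊢ B ⪯ B' → S ⊢ (A' ⊃ B) ⪯ (A ⊃ B')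
  ⪯⊕L    : ∀ {S A B C} → S ⊢ A ⪯ C → S ⊢ B ⪯ C → S ⊢ (A ⊕ B) ⪯ C
  ⪯⊕R₁   : ∀ {S A B C} → S ⊢ A ⪯ B → IsType C → S ⊢ A ⪯ (B ⊕ C)
  ⪯⊕R₂   : ∀ {S A B C} → S ⊢ A ⪯ B → IsType C → S ⊢ A ⪯ (C ⊕ B)
  ⪯μ     : ∀ {S s s' A B} (v w : ℕ) →
           (s , v) ≢ (s' , w) →
           (s , v) ∉ fvs A → (s , v) ∉ fvs B →
           (s' , w) ∉ fvs A → (s' , w) ∉ fvs B →
           (s , v) ∉ assumVars S → (s' , w) ∉ assumVars S →
           (((s , v) , (s' , w)) ∷ S) ⊢ open' A (fv (s , v)) ⪯ open' B (fv (s' , w)) →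
           IsType (μ s A) → IsType (μ s' B) →
           S ⊢ μ s A ⪯ μ s' B

infix 4 _⪯_
_⪯_ : Ty → Ty → Set
A ⪯ B = [] ⊢ A ⪯ B

-- Iterated unions ⊕_{i∈1..n} A_i in any association (n ≥ 1)

data Union : List Ty → Ty → Set where
  one : ∀ {A} → Union [ A ] A
  two : ∀ {l l₁ l₂ T₁ T₂} → Union l₁ T₁ → Union l₂ T₂ → l ≡ l₁ ++ l₂ →
        Union l (T₁ ⊕ T₂)

data Pat : Set where
  pvar : ℕ → Pat
  pcon : ℕ → Pat
  papp : Pat → Pat → Pat

fm : Pat → List ℕ
fm (pvar x) = x ∷ []
fm (pcon c) = []
fm (papp p q) = fm p ++ fm q

Linear : Pat → Set
Linear p = Unique (fm p)

substP : (ℕ → Pat) → Pat → Pat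
substP σ (pvar x) = σ x
substP σ (pcon c) = pcon c
substP σ (papp p q) = papp (substP σ p) (substP σ q)

Subsumes : Pat → Pat → Set
Subsumes p q = ∃[ σ ] substP σ p ≡ q

Ctx : Set
Ctx = ℕ → Maybe Ty

_,,_ : Ctx → Ctx → Ctx
(Γ ,, θ) x with θ x
... | just A = just A
... | nothing = Γ x

CtxOK : Ctx → Set
CtxOK Γ = ∀ x A → Γ x ≡ just A → IsType A

DomEq : Ctx → Pat → Set
DomEq θ p = ∀ x → ((∃[ A ] θ x ≡ just A) → x ∈ fm p) × (x ∈ fm p → ∃[ A ] θ x ≡ just A)

data Term : Set
data Branch : Set

data Term where
  var : ℕ → Term
  con : ℕ → Term
  app : Term → Term → Term
  abs : List Branch → Term

data Branch where
  br : Pat → Ctx → Term → Branch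

data DataStr : Term → Set where
  dsc : ∀ c → DataStr (con c)
  dsa : ∀ {d} t → DataStr d → DataStr (app d t)

data Dir : Set where
  L R : Dir

Pos : Set
Pos = List Dir

sub : Pat → Pos → Maybe Pat
sub p [] = just p
sub (papp p q) (L ∷ π) = sub p π
sub (papp p q) (R ∷ π) = sub q π
sub (pvar x) (d ∷ π) = nothing
sub (pcon c) (d ∷ π) = nothing

_∈pos_ : Pos → Pat → Set
π ∈pos p = ∃[ q ] sub p π ≡ just q

MaxCommon : Pat → Pat → Pos → Set
MaxCommon p q π = π ∈pos p × π ∈pos q ×
  (∀ ρ → (π ++ ρ) ∈pos p → (π ++ ρ) ∈pos q → ρ ≡ [])

data Sym : Set where
  symV : Var → Sym
  symC : ℕ → Sym
  sym⊃ sym＠ : Sym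

data _‖_∋_ : Ty → Pos → Sym → Set where
  ‖fv  : ∀ V → fv V ‖ [] ∋ symV V
  ‖con : ∀ c → con c ‖ [] ∋ symC c
  ‖⊃   : ∀ {A B} → (A ⊃ B) ‖ [] ∋ sym⊃
  ‖＠   : ∀ {A B} → (A ＠ B) ‖ [] ∋ sym＠
  ‖⊃L  : ∀ {A B π a} → A ‖ π ∋ a → (A ⊃ B) ‖ (L ∷ π) ∋ a
  ‖⊃R  : ∀ {A B π a} → B ‖ π ∋ a → (A ⊃ B) ‖ (R ∷ π) ∋ a
  ‖＠L  : ∀ {A B π a} → A ‖ π ∋ a → (A ＠ B) ‖ (L ∷ π) ∋ a
  ‖＠R  : ∀ {A B π a} → B ‖ π ∋ a → (A ＠ B) ‖ (R ∷ π) ∋ a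
  ‖⊕L  : ∀ {A B π a} → A ‖ π ∋ a → (A ⊕ B) ‖ π ∋ a
  ‖⊕R  : ∀ {A B π a} → B ‖ π ∋ a → (A ⊕ B) ‖ π ∋ a
  ‖μ   : ∀ {s A π a} → open' A (μ s A) ‖ π ∋ a → μ s A ‖ π ∋ a

CompatPair : Pat × Ty → Pat × Ty → Set
CompatPair (pi , Ai) (pj , Aj) =
  (Subsumes pi pj → Aj ⪯ Ai) ×
  (¬ Subsumes pi pj →
     (∀ π qi qj → MaxCommon pi pj π → sub pi π ≡ just qi → sub pj π ≡ just qj →
        ¬ Subsumes qi qj → ∃[ a ] (Ai ‖ π ∋ a × Aj ‖ π ∋ a)) →
     Aj ⪯ Ai)

Compatible : List (Pat × Ty) → Set
Compatible [] = ⊤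
Compatible (x ∷ xs) = All (CompatPair x) xs × Compatible xs

infix 4 _⊢p_∶_
data _⊢p_∶_ (θ : Ctx) : Pat → Ty → Set where
  pv : ∀ {x A} → θ x ≡ just A → θ ⊢p pvar x ∶ A
  pc : ∀ c → θ ⊢p pcon c ∶ con c
  pa : ∀ {p q D A} → IsDatatype D → θ ⊢p p ∶ D → θ ⊢p q ∶ A → θ ⊢p papp p q ∶ (D ＠ A)

infix 4 _⊢_∶_
data _⊢_∶_ : Ctx → Term → Ty → Set
data Brs : Ctx → List Branch → List (Pat × Ty) → Ty → Set

data _⊢_∶_ where
  tvar  : ∀ {Γ x A} → Γ x ≡ just A → Γ ⊢ var x ∶ A
  tcon  : ∀ {Γ} c → Γ ⊢ con c ∶ con c
  tappD : ∀ {Γ r u D A} → IsDatatype D → Γ ⊢ r ∶ D → Γ ⊢ u ∶ A → Γ ⊢ app r u ∶ (D ＠ A)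
  tabs  : ∀ {Γ bs pAs B T} → Brs Γ bs pAs B → Compatible pAs →
          Union (map proj₂ pAs) T → Γ ⊢ abs bs ∶ (T ⊃ B)
  tappF : ∀ {Γ r u As T B A} → Γ ⊢ r ∶ (T ⊃ B) → Union As T → A ∈ As →
          Γ ⊢ u ∶ A → Γ ⊢ app r u ∶ B
  tsub  : ∀ {Γ s A A'} → Γ ⊢ s ∶ A → A ⪯ A' → Γ ⊢ s ∶ A'

data Brs where
  []  : ∀ {Γ B} → Brs Γ [] [] B
  bcons : ∀ {Γ p θ s A B bs pAs} →
        Linear p → CtxOK θ → θ ⊢p p ∶ A → DomEq θ p → (Γ ,, θ) ⊢ s ∶ B →
        Brs Γ bs pAs B → Brs Γ (br p θ s ∷ bs) ((p , A) ∷ pAs) B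

module Submission where

-- A data structure c or d t is typed syntactically by the constant
-- rule or the data-application rule, producing c or D @ A; every other
-- typing of it is obtained by further subsumption.  The only other rule that
-- could type an application, functional application r u, would need r — itself
-- a data structure — to have an arrow type, which is impossible: the head
-- symbols of a type (read off through unions and μ-binders) are invariant
-- under ≃μ and non-variable head symbols are preserved by ⪯μ, while the
-- canonical types c and D @ A have no head ⊃.

open import Defs
open import Data.Nat using (zero; suc; _≟_; _≤_; _<_; z≤n; s≤s)
open import Data.Nat.Properties using (<-≤-trans; <-irrefl)
open import Data.Product using (Σ; ∃₂; _×_; _,_; proj₁; proj₂)
open import Data.Empty using (⊥; ⊥-elim)
open import Data.Unit using (⊤; tt)
open import Data.Maybe using (just; nothing)
open import Data.List using ([]; _∷_; _++_; map; length)
open import Data.List.Relation.Unary.All using (All; []; _∷_)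
open import Data.List.Relation.Unary.All.Properties using (++⁻)
open import Relation.Nullary using (¬_; yes; no)
open import Relation.Binary.PropositionalEquality using (_≡_; _≢_; refl; sym; trans; subst; cong)

-- 1. Head symbols

-- a is a head symbol of A: the root symbol of A or of a component of a
-- top-level union, looking through μ-binders without unfolding them.
data Head : Ty → Sym → Set where
  hfv  : ∀ V → Head (fv V) (symV V)
  hcon : ∀ c → Head (con c) (symC c)
  h＠   : ∀ {A B} → Head (A ＠ B) sym＠
  h⊃   : ∀ {A B} → Head (A ⊃ B) sym⊃
  h⊕L  : ∀ {A B a} → Head A a → Head (A ⊕ B) a
  h⊕R  : ∀ {A B a} → Head B a → Head (A ⊕ B) a
  hμ   : ∀ {s A a} → Head A a → Head (μ s A) a

infix 4 _⇒ʰ_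
_⇒ʰ_ : Ty → Ty → Set
A ⇒ʰ B = ∀ {a} → Head A a → Head B a

-- the symbols other than variables; subtyping hypotheses V ⪯ W may change
-- a variable head, but no rule changes a rigid one
Rigid : Sym → Set
Rigid (symV _) = ⊥
Rigid _ = ⊤

arrow-head : ∀ {A B a} → Head (A ⊃ B) a → a ≡ sym⊃
arrow-head h⊃ = refl

head-open : ∀ {k U A a} → Head A a → Head (openRec k U A) a
head-open (hfv V) = hfv V
head-open (hcon c) = hcon c
head-open h＠ = h＠
head-open h⊃ = h⊃
head-open (h⊕L h) = h⊕L (head-open h)
head-open (h⊕R h) = h⊕R (head-open h)
head-open (hμ h) = hμ (head-open h)

head-unopen : ∀ k U A {a} → Guarded k A → Head (openRec k U A) a → Head A a
head-unopen k U (fv V) g h = h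
head-unopen k U (bv i) g h with i ≟ k
... | yes i≡k = ⊥-elim (g i≡k)
... | no _ with h
...   | ()
head-unopen k U (con c) g h = h
head-unopen k U (A ＠ B) g h＠ = h＠
head-unopen k U (A ⊃ B) g h⊃ = h⊃
head-unopen k U (A ⊕ B) (gA , gB) (h⊕L h) = h⊕L (head-unopen k U A gA h)
head-unopen k U (A ⊕ B) (gA , gB) (h⊕R h) = h⊕R (head-unopen k U B gB h)
head-unopen k U (μ s A) g (hμ h) = hμ (head-unopen (suc k) U A g h)

μ-guarded : ∀ {s A} → IsType (μ s A) → Guarded 0 A
μ-guarded (_ , g , _) = g

μ⇒ʰopen : ∀ {s A} U → μ s A ⇒ʰ open' A U
μ⇒ʰopen U (hμ h) = head-open h

open⇒ʰμ : ∀ {s A} U → IsType (μ s A) → open' A U ⇒ʰ μ s A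
open⇒ʰμ {A = A} U ok h = hμ (head-unopen 0 U A (μ-guarded ok) h)

⊕⇒ʰ : ∀ {A A' B B'} → A ⇒ʰ A' → B ⇒ʰ B' → A ⊕ B ⇒ʰ A' ⊕ B'
⊕⇒ʰ f g (h⊕L h) = h⊕L (f h)
⊕⇒ʰ f g (h⊕R h) = h⊕R (g h)

SameHeads : Ty → Ty → Set
SameHeads A B = (A ⇒ʰ B) × (B ⇒ʰ A)

≃-heads : ∀ {A B} → A ≃ B → SameHeads A B
≃-heads (≃refl _) = (λ h → h) , (λ h → h)
≃-heads (≃sym e) = proj₂ (≃-heads e) , proj₁ (≃-heads e)
≃-heads (≃trans e f) =
  (λ h → proj₁ (≃-heads f) (proj₁ (≃-heads e) h)) , (λ h → proj₂ (≃-heads e) (proj₂ (≃-heads f) h))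
≃-heads (≃＠ _ _ _ _) = (λ { h＠ → h＠ }) , (λ { h＠ → h＠ })
≃-heads (≃⊃ _ _) = (λ { h⊃ → h⊃ }) , (λ { h⊃ → h⊃ })
≃-heads (≃⊕ e f) = ⊕⇒ʰ (proj₁ (≃-heads e)) (proj₁ (≃-heads f)) , ⊕⇒ʰ (proj₂ (≃-heads e)) (proj₂ (≃-heads f))
≃-heads (≃μ {s} V _ _ e okA okB) =
  (λ h → open⇒ʰμ (fv (s , V)) okB (proj₁ (≃-heads e) (μ⇒ʰopen (fv (s , V)) h))) ,
  (λ h → open⇒ʰμ (fv (s , V)) okA (proj₂ (≃-heads e) (μ⇒ʰopen (fv (s , V)) h)))
≃-heads (≃idem _) = (λ { (h⊕L h) → h ; (h⊕R h) → h }) , h⊕L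
≃-heads (≃comm _ _) = swap , swap
  where
    swap : ∀ {A B} → A ⊕ B ⇒ʰ B ⊕ A
    swap (h⊕L h) = h⊕R h
    swap (h⊕R h) = h⊕L h
≃-heads (≃assoc _ _ _) =
  (λ { (h⊕L h) → h⊕L (h⊕L h) ; (h⊕R (h⊕L h)) → h⊕L (h⊕R h) ; (h⊕R (h⊕R h)) → h⊕R h }) ,
  (λ { (h⊕L (h⊕L h)) → h⊕L h ; (h⊕L (h⊕R h)) → h⊕R (h⊕L h) ; (h⊕R h) → h⊕R (h⊕R h) })
≃-heads (≃fold {s} {A} ok) = μ⇒ʰopen (μ s A) , open⇒ʰμ (μ s A) ok
≃-heads (≃contr {A = A} e okB) =
  (λ h → open⇒ʰμ A okB (proj₁ (≃-heads e) h)) , (λ h → proj₂ (≃-heads e) (μ⇒ʰopen A h))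

⪯-heads : ∀ {S A B a} → S ⊢ A ⪯ B → Rigid a → Head A a → Head B a
⪯-heads (⪯refl _) r h = h
⪯-heads (⪯hyp _) () (hfv _)
⪯-heads (⪯eq e) r h = proj₁ (≃-heads e) h
⪯-heads (⪯trans p q) r h = ⪯-heads q r (⪯-heads p r h)
⪯-heads (⪯＠ _ _ _ _) r h＠ = h＠
⪯-heads (⪯⊃ _ _) r h⊃ = h⊃
⪯-heads (⪯⊕L p q) r (h⊕L h) = ⪯-heads p r h
⪯-heads (⪯⊕L p q) r (h⊕R h) = ⪯-heads q r h
⪯-heads (⪯⊕R₁ p _) r h = h⊕L (⪯-heads p r h)
⪯-heads (⪯⊕R₂ p _) r h = h⊕R (⪯-heads p r h)
⪯-heads (⪯μ {s = s} {s' = s'} v w _ _ _ _ _ _ _ p _ okB) r (hμ h) =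
  open⇒ʰμ (fv (s' , w)) okB (⪯-heads p r (head-open h))

-- 2. Regularity

lookup-++ : ∀ ss ext i {s} → lookupS ss i ≡ just s → lookupS (ss ++ ext) i ≡ just s
lookup-++ (_ ∷ ss) ext zero e = e
lookup-++ (_ ∷ ss) ext (suc i) e = lookup-++ ss ext i e

weaken-DT : ∀ {ss D} ext → DT ss D → DT (ss ++ ext) D
weaken-TY : ∀ {ss A} ext → TY ss A → TY (ss ++ ext) A
weaken-DT ext (dfv n) = dfv n
weaken-DT {ss} ext (dbv i e) = dbv i (lookup-++ ss ext i e)
weaken-DT ext (dcon c) = dcon c
weaken-DT ext (d＠ D A) = d＠ (weaken-DT ext D) (weaken-TY ext A)
weaken-DT ext (d⊕ D D') = d⊕ (weaken-DT ext D) (weaken-DT ext D')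
weaken-DT ext (dμ D) = dμ (weaken-DT ext D)
weaken-TY ext (tfv n) = tfv n
weaken-TY {ss} ext (tbv i e) = tbv i (lookup-++ ss ext i e)
weaken-TY ext (tdt D) = tdt (weaken-DT ext D)
weaken-TY ext (t⊃ A B) = t⊃ (weaken-TY ext A) (weaken-TY ext B)
weaken-TY ext (t⊕ A B) = t⊕ (weaken-TY ext A) (weaken-TY ext B)
weaken-TY ext (tμ A) = tμ (weaken-TY ext A)

lookup-last : ∀ pre s → lookupS (pre ++ s ∷ []) (length pre) ≡ just s
lookup-last [] s = refl
lookup-last (_ ∷ pre) s = lookup-last pre s

lookup-init : ∀ pre s i {s'} → lookupS (pre ++ s ∷ []) i ≡ just s' → i ≢ length pre →
              lookupS pre i ≡ just s'
lookup-init [] s zero e ne = ⊥-elim (ne refl)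
lookup-init (_ ∷ pre) s zero e ne = e
lookup-init (_ ∷ pre) s (suc i) e ne = lookup-init pre s i e (λ i≡ → ne (cong suc i≡))

ClosedOfSort : Sort → Ty → Set
ClosedOfSort dsort U = DT [] U
ClosedOfSort tsort U = TY [] U

closed-DT : ∀ pre s {U} → ClosedOfSort s U → lookupS (pre ++ s ∷ []) (length pre) ≡ just dsort →
            DT pre U
closed-DT pre dsort U e = weaken-DT pre U
closed-DT pre tsort U e with trans (sym (lookup-last pre tsort)) e
... | ()

closed-TY : ∀ pre s {U} → ClosedOfSort s U → lookupS (pre ++ s ∷ []) (length pre) ≡ just tsort →
            TY pre U
closed-TY pre tsort U e = weaken-TY pre U
closed-TY pre dsort U e with trans (sym (lookup-last pre dsort)) e
... | ()

open-DT : ∀ pre s {U D} → ClosedOfSort s U → DT (pre ++ s ∷ []) D → DT pre (openRec (length pre) U D)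
open-TY : ∀ pre s {U A} → ClosedOfSort s U → TY (pre ++ s ∷ []) A → TY pre (openRec (length pre) U A)
open-DT pre s U (dfv n) = dfv n
open-DT pre s U (dbv i e) with i ≟ length pre
... | yes refl = closed-DT pre s U e
... | no ne = dbv i (lookup-init pre s i e ne)
open-DT pre s U (dcon c) = dcon c
open-DT pre s U (d＠ D A) = d＠ (open-DT pre s U D) (open-TY pre s U A)
open-DT pre s U (d⊕ D D') = d⊕ (open-DT pre s U D) (open-DT pre s U D')
open-DT pre s U (dμ D) = dμ (open-DT (dsort ∷ pre) s U D)
open-TY pre s U (tfv n) = tfv n
open-TY pre s U (tbv i e) with i ≟ length pre
... | yes refl = closed-TY pre s U e
... | no ne = tbv i (lookup-init pre s i e ne)
open-TY pre s U (tdt D) = tdt (open-DT pre s U D)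
open-TY pre s U (t⊃ A B) = t⊃ (open-TY pre s U A) (open-TY pre s U B)
open-TY pre s U (t⊕ A B) = t⊕ (open-TY pre s U A) (open-TY pre s U B)
open-TY pre s U (tμ A) = tμ (open-TY (tsort ∷ pre) s U A)

-- an index beyond the binders in scope does not occur, so it is guarded;
-- in particular a closed type is guarded at every index
lookup-bound : ∀ ss i {s} → lookupS ss i ≡ just s → i < length ss
lookup-bound (_ ∷ ss) zero e = s≤s z≤n
lookup-bound (_ ∷ ss) (suc i) e = s≤s (lookup-bound ss i e)

DT-guarded : ∀ {ss D} → DT ss D → ∀ n → length ss ≤ n → Guarded n D
TY-guarded : ∀ {ss A} → TY ss A → ∀ n → length ss ≤ n → Guarded n A
DT-guarded (dfv _) n le = tt
DT-guarded {ss} (dbv i e) n le refl = <-irrefl refl (<-≤-trans (lookup-bound ss i e) le)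
DT-guarded (dcon _) n le = tt
DT-guarded (d＠ _ _) n le = tt
DT-guarded (d⊕ D D') n le = DT-guarded D n le , DT-guarded D' n le
DT-guarded (dμ D) n le = DT-guarded D (suc n) (s≤s le)
TY-guarded (tfv _) n le = tt
TY-guarded {ss} (tbv i e) n le refl = <-irrefl refl (<-≤-trans (lookup-bound ss i e) le)
TY-guarded (tdt D) n le = DT-guarded D n le
TY-guarded (t⊃ _ _) n le = tt
TY-guarded (t⊕ A B) n le = TY-guarded A n le , TY-guarded B n le
TY-guarded (tμ A) n le = TY-guarded A (suc n) (s≤s le)

open-guarded : ∀ j k U B → Guarded j B → (∀ n → Guarded n U) → Guarded j (openRec k U B)
open-guarded j k U (fv V) g gU = tt
open-guarded j k U (bv i) g gU with i ≟ k
... | yes _ = gU j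
... | no _ = g
open-guarded j k U (con c) g gU = tt
open-guarded j k U (A ＠ B) g gU = tt
open-guarded j k U (A ⊃ B) g gU = tt
open-guarded j k U (A ⊕ B) (gA , gB) gU = open-guarded j k U A gA gU , open-guarded j k U B gB gU
open-guarded j k U (μ s A) g gU = open-guarded (suc j) (suc k) U A g gU

open-contr : ∀ k U B → Contr B → Contr U → (∀ n → Guarded n U) → Contr (openRec k U B)
open-contr k U (fv V) c cU gU = tt
open-contr k U (bv i) c cU gU with i ≟ k
... | yes _ = cU
... | no _ = tt
open-contr k U (con c) _ cU gU = tt
open-contr k U (A ＠ B) (cA , cB) cU gU = open-contr k U A cA cU gU , open-contr k U B cB cU gU
open-contr k U (A ⊃ B) (cA , cB) cU gU = open-contr k U A cA cU gU , open-contr k U B cB cU gU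
open-contr k U (A ⊕ B) (cA , cB) cU gU = open-contr k U A cA cU gU , open-contr k U B cB cU gU
open-contr k U (μ s A) (g , c) cU gU = open-guarded 0 (suc k) U A g gU , open-contr (suc k) U A c cU gU

unfold-type : ∀ {s A} → IsType (μ s A) → IsType (open' A (μ s A))
unfold-type {tsort} {A} (tμ wf , c) =
  open-TY [] tsort (tμ wf) wf , open-contr 0 (μ tsort A) A (proj₂ c) c (λ n → TY-guarded (tμ wf) n z≤n)
unfold-type {dsort} {A} (tdt (dμ wf) , c) =
  tdt (open-DT [] dsort (dμ wf) wf) , open-contr 0 (μ dsort A) A (proj₂ c) c (λ n → DT-guarded (dμ wf) n z≤n)

datatype-type : ∀ {D} → IsDatatype D → IsType D
datatype-type (wf , c) = tdt wf , c

fv-type : ∀ V → IsType (fv V)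
fv-type (dsort , n) = tdt (dfv n) , tt
fv-type (tsort , n) = tfv n , tt

⊃-type : ∀ {A B} → IsType A → IsType B → IsType (A ⊃ B)
⊃-type (wfA , cA) (wfB , cB) = t⊃ wfA wfB , cA , cB

⊃-type⁻ : ∀ {A B} → IsType (A ⊃ B) → IsType B
⊃-type⁻ (t⊃ _ wfB , _ , cB) = wfB , cB
⊃-type⁻ (tdt () , _)

⊕-type : ∀ {A B} → IsType A → IsType B → IsType (A ⊕ B)
⊕-type (wfA , cA) (wfB , cB) = t⊕ wfA wfB , cA , cB

≃-regular : ∀ {A B} → A ≃ B → IsType A × IsType B
≃-regular (≃refl ok) = ok , ok
≃-regular (≃sym e) = proj₂ (≃-regular e) , proj₁ (≃-regular e)
≃-regular (≃trans e f) = proj₁ (≃-regular e) , proj₂ (≃-regular f)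
≃-regular (≃＠ _ _ okL okR) = okL , okR
≃-regular (≃⊃ e f) =
  ⊃-type (proj₁ (≃-regular e)) (proj₁ (≃-regular f)) , ⊃-type (proj₂ (≃-regular e)) (proj₂ (≃-regular f))
≃-regular (≃⊕ e f) =
  ⊕-type (proj₁ (≃-regular e)) (proj₁ (≃-regular f)) , ⊕-type (proj₂ (≃-regular e)) (proj₂ (≃-regular f))
≃-regular (≃μ _ _ _ _ okL okR) = okL , okR
≃-regular (≃idem ok) = ⊕-type ok ok , ok
≃-regular (≃comm okA okB) = ⊕-type okA okB , ⊕-type okB okA
≃-regular (≃assoc okA okB okC) = ⊕-type okA (⊕-type okB okC) , ⊕-type (⊕-type okA okB) okC
≃-regular (≃fold ok) = ok , unfold-type ok
≃-regular (≃contr e ok) = proj₁ (≃-regular e) , ok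

⪯-regular : ∀ {S A B} → S ⊢ A ⪯ B → IsType A × IsType B
⪯-regular (⪯refl ok) = ok , ok
⪯-regular (⪯hyp {V = V} {W = W} _) = fv-type V , fv-type W
⪯-regular (⪯eq e) = ≃-regular e
⪯-regular (⪯trans p q) = proj₁ (⪯-regular p) , proj₂ (⪯-regular q)
⪯-regular (⪯＠ _ _ okL okR) = okL , okR
⪯-regular (⪯⊃ p q) =
  ⊃-type (proj₂ (⪯-regular p)) (proj₁ (⪯-regular q)) , ⊃-type (proj₁ (⪯-regular p)) (proj₂ (⪯-regular q))
⪯-regular (⪯⊕L p q) = ⊕-type (proj₁ (⪯-regular p)) (proj₁ (⪯-regular q)) , proj₂ (⪯-regular p)
⪯-regular (⪯⊕R₁ p ok) = proj₁ (⪯-regular p) , ⊕-type (proj₂ (⪯-regular p)) ok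
⪯-regular (⪯⊕R₂ p ok) = proj₁ (⪯-regular p) , ⊕-type ok (proj₂ (⪯-regular p))
⪯-regular (⪯μ _ _ _ _ _ _ _ _ _ _ okL okR) = okL , okR

union-type : ∀ {l T} → All IsType l → Union l T → IsType T
union-type (ok ∷ []) one = ok
union-type oks (two {l₁ = l₁} u₁ u₂ e) =
  ⊕-type (union-type (proj₁ split) u₁) (union-type (proj₂ split) u₂)
  where split = ++⁻ l₁ (subst (All IsType) e oks)

union-nonempty : ∀ {T} → ¬ Union [] T
union-nonempty (two {l₁ = []} u₁ u₂ e) = union-nonempty u₁
union-nonempty (two {l₁ = _ ∷ _} u₁ u₂ ())

pattern-type : ∀ {θ p A} → CtxOK θ → θ ⊢p p ∶ A → IsType A
pattern-type ok (pv {x} {A} e) = ok x A e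
pattern-type ok (pc c) = tdt (dcon c) , tt
pattern-type ok (pa (wfD , cD) p q) with pattern-type ok q
... | wfA , cA = tdt (d＠ wfD wfA) , cD , cA

extend-ok : ∀ {Γ θ} → CtxOK Γ → CtxOK θ → CtxOK (Γ ,, θ)
extend-ok {Γ} {θ} okΓ okθ x A e with θ x in θx
... | just B with e
...   | refl = okθ x B θx
extend-ok okΓ okθ x A e | nothing = okΓ x A e

typing-regular : ∀ {Γ t A} → CtxOK Γ → Γ ⊢ t ∶ A → IsType A
branches-patterns : ∀ {Γ bs pAs B} → CtxOK Γ → Brs Γ bs pAs B → All IsType (map proj₂ pAs)
branches-body : ∀ {Γ bs pAs B T} → CtxOK Γ → Brs Γ bs pAs B → Union (map proj₂ pAs) T → IsType B

typing-regular ok (tvar {x = x} {A = A} e) = ok x A e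
typing-regular ok (tcon c) = tdt (dcon c) , tt
typing-regular ok (tappD (wfD , cD) r u) with typing-regular ok u
... | wfA , cA = tdt (d＠ wfD wfA) , cD , cA
typing-regular ok (tabs bs _ u) = ⊃-type (union-type (branches-patterns ok bs) u) (branches-body ok bs u)
typing-regular ok (tappF r _ _ _) = ⊃-type⁻ (typing-regular ok r)
typing-regular ok (tsub _ p) = proj₂ (⪯-regular p)

branches-patterns ok [] = []
branches-patterns ok (bcons _ okθ p _ _ bs) = pattern-type okθ p ∷ branches-patterns ok bs

branches-body ok [] u = ⊥-elim (union-nonempty u)
branches-body ok (bcons _ okθ _ _ s _) u = typing-regular (extend-ok ok okθ) s

-- 3. Canonical typings of data structures

data Canonical (Γ : Ctx) : Term → Ty → Set where
  canon-con : ∀ c → Canonical Γ (con c) (con c)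
  canon-app : ∀ {d t D A} → IsDatatype D → Γ ⊢ d ∶ D → Γ ⊢ t ∶ A → Canonical Γ (app d t) (D ＠ A)

canonical-typing : ∀ {Γ d D} → Canonical Γ d D → Γ ⊢ d ∶ D
canonical-typing (canon-con c) = tcon c
canonical-typing (canon-app okD r u) = tappD okD r u

canonical-nonunion : ∀ {Γ d D} → Canonical Γ d D → NonUnion D
canonical-nonunion (canon-con c) = nucon c
canonical-nonunion (canon-app {D = D} {A = A} _ _ _) = nu＠ D A

canonical-datatype : ∀ {Γ d D} → CtxOK Γ → Canonical Γ d D → IsDatatype D
canonical-datatype ok (canon-con c) = dcon c , tt
canonical-datatype ok (canon-app (wfD , cD) _ u) with typing-regular ok u
... | wfA , cA = d＠ wfD wfA , cD , cA

-- a canonical type has a rigid head other than ⊃, so it is below no arrow type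
canonical-not-arrow : ∀ {Γ d D T B} → Canonical Γ d D → ¬ (D ⪯ T ⊃ B)
canonical-not-arrow (canon-con c) D⪯T⊃B with arrow-head (⪯-heads D⪯T⊃B tt (hcon c))
... | ()
canonical-not-arrow (canon-app _ _ _) D⪯T⊃B with arrow-head (⪯-heads D⪯T⊃B tt h＠)
... | ()

canonical-shape : ∀ {Γ d D} → CtxOK Γ → Canonical Γ d D →
  (∀ c → d ≡ con c → D ≃ con c) ×
  (∀ d' t → d ≡ app d' t → ∃₂ (λ D' A' → D ≃ (D' ＠ A') × Γ ⊢ d' ∶ D' × Γ ⊢ t ∶ A'))
canonical-shape ok can@(canon-con c) = (λ { _ refl → D≃D }) , (λ _ _ ())
  where D≃D = ≃refl (datatype-type (canonical-datatype ok can))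
canonical-shape ok can@(canon-app {D = D} {A = A} _ r u) =
  (λ _ ()) , (λ { _ _ refl → D , A , D≃D , r , u })
  where D≃D = ≃refl (datatype-type (canonical-datatype ok can))

data-inversion : ∀ {Γ d A} → CtxOK Γ → DataStr d → Γ ⊢ d ∶ A → Σ Ty (λ D → Canonical Γ d D × D ⪯ A)
data-inversion ok (dsc c) (tcon c) = con c , canon-con c , ⪯refl (tdt (dcon c) , tt)
data-inversion ok (dsa _ _) (tappD okD r u) =
  _ , can , ⪯refl (datatype-type (canonical-datatype ok can))
  where can = canon-app okD r u
data-inversion ok (dsa _ ds) (tappF r _ _ _) with data-inversion ok ds r
... | _ , can , D⪯T⊃B = ⊥-elim (canonical-not-arrow can D⪯T⊃B)
data-inversion ok ds (tsub der A⪯A') with data-inversion ok ds der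
... | D , can , D⪯A = D , can , ⪯trans D⪯A A⪯A'

lemma3p42 : (Γ : Ctx) (d : Term) (A : Ty) → CtxOK Γ → DataStr d → Γ ⊢ d ∶ A →
    Σ Ty (λ D → IsDatatype D × NonUnion D × D ⪯ A × Γ ⊢ d ∶ D ×
      (∀ c → d ≡ con c → D ≃ con c) ×
      (∀ d' t → d ≡ app d' t →
        ∃₂ (λ D' A' → D ≃ (D' ＠ A') × Γ ⊢ d' ∶ D' × Γ ⊢ t ∶ A')))
lemma3p42 Γ d A ok ds der with data-inversion ok ds der
... | D , can , D⪯A =
  D , canonical-datatype ok can , canonical-nonunion can , D⪯A , canonical-typing can ,
  canonical-shape ok can
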